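{- Let $C'(\Lambda_n,x)=\sum_{p\geq 0} g_{n,p}x^p$, where $g_{n,p}$ is the number of maximal hypercubes of dimension $p$ in the Lucas cube $\Lambda_n$. Then \[C'(\Lambda_n,x)=x\bigl(C'(\Lambda_{n-2},x)+C'(\Lambda_{n-3},x)\bigr)\quad (n\geq 5),\] with $C'(\Lambda_0,x)=1$, $C'(\Lambda_1,x)=1$, $C'(\Lambda_2,x)=2x$, $C'(\Lambda_3,x)=3x$, $C'(\Lambda_4,x)=2x^2$, and the generating function is \[\sum_{n\geq0}C'(\Lambda_n,x)y^n=\frac{1+y+xy^2+xy^3-xy^4}{1-xy^2(1+y)}.\]
   Context: $Q_n$ is the $n$-dimensional hypercube: vertices are binary strings of length $n$, adjacent iff they differ in exactly one coordinate. A Lucas string of length $n$ is a binary string $b_1\dots b_n$ with $b_ib_{i+1}=0$ for $1\le i<n$ and $b_1b_n\neq1$. The Lucas cube $\Lambda_n$ ($n\ge1$) is the subgraph of $Q_n$ induced by the Lucas strings of length $n$, and $\Lambda_0=K_1$. A hypercube of dimension $p$ in $\Lambda_n$ is an induced subgraph isomorphic to $Q_p$; it is maximal if it is not contained in any induced subgraph of $\Lambda_n$ isomorphic to $Q_{p+1}$. -}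

module Defs where

open import Data.Bool using (Bool; true; false; _∧_; not)
open import Data.Nat using (ℕ; zero; suc; _+_; _∸_; _≤_)
open import Data.Integer as ℤ using (ℤ; +_; -_)
open import Data.Fin using (Fin)
open import Data.Vec using (Vec; []; _∷_)
open import Data.List using (List; []; _∷_)
open import Data.Product using (Σ; _×_; _,_)
open import Relation.Binary.PropositionalEquality using (_≡_)
open import Relation.Nullary using (¬_)

-- Hypercube Q_n: vertices are binary strings of length n

Vtx : ℕ → Set
Vtx n = Vec Bool n

ham : ∀ {n} → Vtx n → Vtx n → ℕ
ham [] [] = 0
ham (a ∷ u) (b ∷ v) with a Data.Bool.≟ b
... | Relation.Nullary.yes _ = ham u v
... | Relation.Nullary.no _ = suc (ham u v)

Adj : ∀ {n} → Vtx n → Vtx n → Set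
Adj u v = ham u v ≡ 1

noConsec : ∀ {n} → Vtx n → Bool
noConsec [] = true
noConsec (a ∷ []) = true
noConsec (a ∷ b ∷ v) = not (a ∧ b) ∧ noConsec (b ∷ v)

lastB : ∀ {n} → Vtx (suc n) → Bool
lastB (a ∷ []) = a
lastB (a ∷ b ∷ v) = lastB (b ∷ v)

-- Lucas string: no two consecutive 1s and b_1 b_n ≠ 1 (n ≥ 1);
-- the empty string is the unique vertex of Λ_0 = K_1.
isLucas : ∀ {n} → Vtx n → Bool
isLucas [] = true
isLucas (a ∷ v) = noConsec (a ∷ v) ∧ not (a ∧ lastB (a ∷ v))

VSet : ℕ → Set
VSet n = Vtx n → Bool

_≐_ : ∀ {n} → VSet n → VSet n → Set
S ≐ T = ∀ v → S v ≡ T v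

_⊆_ : ∀ {n} → VSet n → VSet n → Set
S ⊆ T = ∀ v → S v ≡ true → T v ≡ true

InducedIsoQ : ∀ {n} (p : ℕ) → VSet n → Set
InducedIsoQ {n} p S =
  Σ (Vtx p → Vtx n) λ φ →
    (∀ w → S (φ w) ≡ true) ×
    (∀ v → S v ≡ true → Σ (Vtx p) λ w → φ w ≡ v) ×
    (∀ a b → φ a ≡ φ b → a ≡ b) ×
    (∀ a b → (Adj a b → Adj (φ a) (φ b)) × (Adj (φ a) (φ b) → Adj a b))

-- A hypercube of dimension p in Λ_n: an induced subgraph of Λ_n
-- (equivalently, of Q_n on a set of Lucas strings) isomorphic to Q_p.
IsHypercube : (n p : ℕ) → VSet n → Set
IsHypercube n p S = (∀ v → S v ≡ true → isLucas v ≡ true) × InducedIsoQ p S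

IsMaxHypercube : (n p : ℕ) → VSet n → Set
IsMaxHypercube n p S =
  IsHypercube n p S × (∀ T → IsHypercube n (suc p) T → ¬ (S ⊆ T))

HasCount : ∀ {n} → (VSet n → Set) → ℕ → Set
HasCount {n} P k =
  Σ (Fin k → VSet n) λ f →
    (∀ i → P (f i)) ×
    (∀ i j → f i ≐ f j → i ≡ j) ×
    (∀ S → P S → Σ (Fin k) λ i → f i ≐ S)

coeffs : List ℕ → ℕ → ℕ
coeffs [] p = 0
coeffs (c ∷ cs) zero = c
coeffs (c ∷ cs) (suc p) = coeffs cs p

-- Formal power series in y and x with integer coefficients:
-- F n p is the coefficient of y^n x^p.

PS2 : Set
PS2 = ℕ → ℕ → ℤ

sumTo : ℕ → (ℕ → ℤ) → ℤ
sumTo zero f = f 0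
sumTo (suc n) f = sumTo n f ℤ.+ f (suc n)

_⊛_ : PS2 → PS2 → PS2
(F ⊛ G) n p = sumTo n λ i → sumTo p λ j → F i j ℤ.* G (n ∸ i) (p ∸ j)

denom : PS2
denom 0 0 = + 1
denom 2 1 = - + 1
denom 3 1 = - + 1
denom _ _ = + 0

numer : PS2
numer 0 0 = + 1
numer 1 0 = + 1
numer 2 1 = + 1
numer 3 1 = + 1
numer 4 1 = - + 1
numer _ _ = + 0

-- An induced Q_p in Q_n is a subcube: the images of the two halves of Q_p are subcubes that
-- are translates of each other along one direction.  Since Lucas strings are closed under
-- lowering bits, maximality forces a hypercube of Λ_n to be the whole downset of a Lucas
-- string t none of whose bits can be raised (a maximal independent set of the n-cycle), and
-- its dimension is the weight of t.  For n ≥ 5 every such string arises uniquely from a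
-- shorter one by inserting 10 or 100 in front of its first one, which raises the weight by
-- one; this is the recurrence, and multiplying by 1 - x y² - x y³ kills every coefficient
-- beyond the initial terms.

module Submission where

open import Defs
open import Algebra.Properties.AbelianGroup using (xyx⁻¹≈y)
open import Data.Bool using (Bool; true; false; _∧_; _∨_; not)
open import Data.Bool.Properties using (∨-zeroʳ; ∧-assoc; ∧-comm)
open import Data.Empty using (⊥; ⊥-elim)
open import Data.Fin using (Fin; zero; suc)
open import Data.Integer as ℤ using (ℤ; +_)
import Data.Integer.Properties as ℤ
open import Data.List as List using (List; []; _∷_; map; _++_; length)
open import Data.List.Membership.Propositional using (_∈_)
open import Data.List.Membership.Propositional.Properties using (∈-map⁺; ∈-map⁻; ∈-++⁺ˡ; ∈-++⁺ʳ; ∈-lookup)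
open import Data.List.Properties using (length-++; length-map)
open import Data.List.Relation.Unary.All as All using (All; []; _∷_)
import Data.List.Relation.Unary.All.Properties as All
open import Data.List.Relation.Unary.AllPairs using ([]; _∷_)
open import Data.List.Relation.Unary.Any as Any using (here; there)
open import Data.List.Relation.Unary.Any.Properties using (lookup-index)
open import Data.List.Relation.Unary.Unique.Propositional using (Unique)
import Data.List.Relation.Unary.Unique.Propositional.Properties as Unique
open import Data.Nat using (ℕ; zero; suc; _+_; _∸_; _≤_; z≤n; s≤s)
open import Data.Nat.Properties using (suc-injective; m≤n⇒m≤1+n; <-irrefl)
open import Data.Product using (Σ; _×_; _,_; proj₁; proj₂)
open import Data.Sum using (_⊎_; inj₁; inj₂)
open import Data.Vec using ([]; _∷_; lookup; replicate; zipWith)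
open import Data.Vec.Properties using (∷-injectiveʳ)
open import Function using (case_of_)
open import Relation.Binary.PropositionalEquality
  using (_≡_; _≢_; refl; sym; trans; cong; cong₂; subst; subst₂; module ≡-Reasoning)
open import Relation.Nullary using (¬_)

∧-trueˡ : ∀ {a b} → a ∧ b ≡ true → a ≡ true
∧-trueˡ {true} _ = refl

∧-trueʳ : ∀ {a b} → a ∧ b ≡ true → b ≡ true
∧-trueʳ {true} e = e

∧-true : ∀ {a b} → a ≡ true → b ≡ true → a ∧ b ≡ true
∧-true refl refl = refl

true≢false : true ≢ false
true≢false ()

≡true-ext : ∀ {a b} → (a ≡ true → b ≡ true) → (b ≡ true → a ≡ true) → a ≡ b
≡true-ext {true} f g = sym (f refl)
≡true-ext {false} {true} f g = g refl
≡true-ext {false} {false} f g = refl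

zeros : ∀ {n} → Vtx n
zeros = replicate _ false

toggle : ∀ {n} → Fin n → Vtx n → Vtx n
toggle zero (a ∷ v) = not a ∷ v
toggle (suc i) (a ∷ v) = a ∷ toggle i v

weight : ∀ {n} → Vtx n → ℕ
weight [] = 0
weight (true ∷ v) = suc (weight v)
weight (false ∷ v) = weight v

infix 7 _≤ᵇ_ _≡ᵇ_ _⊑ᵇ_

_≤ᵇ_ : Bool → Bool → Bool
a ≤ᵇ b = not a ∨ b

_≡ᵇ_ : Bool → Bool → Bool
true ≡ᵇ true = true
false ≡ᵇ false = true
_ ≡ᵇ _ = false

_⊑ᵇ_ : ∀ {n} → Vtx n → Vtx n → Bool
[] ⊑ᵇ [] = true
(a ∷ u) ⊑ᵇ (b ∷ v) = (a ≤ᵇ b) ∧ (u ⊑ᵇ v)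

-- subcube u M: the vertices that agree with u at every coordinate outside the direction set M.
subcube : ∀ {n} → Vtx n → Vtx n → VSet n
subcube [] [] [] = true
subcube (a ∷ u) (m ∷ M) (x ∷ v) = (m ∨ x ≡ᵇ a) ∧ subcube u M v

downset : ∀ {n} → Vtx n → VSet n
downset t = subcube zeros t

ham-refl : ∀ {n} (u : Vtx n) → ham u u ≡ 0
ham-refl [] = refl
ham-refl (true ∷ u) = ham-refl u
ham-refl (false ∷ u) = ham-refl u

ham≡0⇒≡ : ∀ {n} (u v : Vtx n) → ham u v ≡ 0 → u ≡ v
ham≡0⇒≡ [] [] _ = refl
ham≡0⇒≡ (true ∷ u) (true ∷ v) e = cong (true ∷_) (ham≡0⇒≡ u v e)
ham≡0⇒≡ (false ∷ u) (false ∷ v) e = cong (false ∷_) (ham≡0⇒≡ u v e)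
ham≡0⇒≡ (true ∷ u) (false ∷ v) ()
ham≡0⇒≡ (false ∷ u) (true ∷ v) ()

Adj-toggle : ∀ {n} (i : Fin n) (u : Vtx n) → Adj u (toggle i u)
Adj-toggle zero (true ∷ u) = cong suc (ham-refl u)
Adj-toggle zero (false ∷ u) = cong suc (ham-refl u)
Adj-toggle (suc i) (true ∷ u) = Adj-toggle i u
Adj-toggle (suc i) (false ∷ u) = Adj-toggle i u

Adj⇒toggle : ∀ {n} (u v : Vtx n) → Adj u v → Σ (Fin n) λ i → v ≡ toggle i u
Adj⇒toggle [] [] ()
Adj⇒toggle (true ∷ u) (true ∷ v) e = let (i , p) = Adj⇒toggle u v e in suc i , cong (true ∷_) p
Adj⇒toggle (false ∷ u) (false ∷ v) e = let (i , p) = Adj⇒toggle u v e in suc i , cong (false ∷_) p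
Adj⇒toggle (true ∷ u) (false ∷ v) e = zero , cong (false ∷_) (sym (ham≡0⇒≡ u v (suc-injective e)))
Adj⇒toggle (false ∷ u) (true ∷ v) e = zero , cong (true ∷_) (sym (ham≡0⇒≡ u v (suc-injective e)))

toggle-involutive : ∀ {n} (i : Fin n) (u : Vtx n) → toggle i (toggle i u) ≡ u
toggle-involutive zero (true ∷ u) = refl
toggle-involutive zero (false ∷ u) = refl
toggle-involutive (suc i) (a ∷ u) = cong (a ∷_) (toggle-involutive i u)

toggle-comm : ∀ {n} (i j : Fin n) (u : Vtx n) → toggle i (toggle j u) ≡ toggle j (toggle i u)
toggle-comm zero zero u = refl
toggle-comm zero (suc j) (a ∷ u) = refl
toggle-comm (suc i) zero (a ∷ u) = refl
toggle-comm (suc i) (suc j) (a ∷ u) = cong (a ∷_) (toggle-comm i j u)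

toggle-injectiveˡ : ∀ {n} (i j : Fin n) (u : Vtx n) → toggle i u ≡ toggle j u → i ≡ j
toggle-injectiveˡ zero zero u e = refl
toggle-injectiveˡ zero (suc j) (true ∷ u) ()
toggle-injectiveˡ zero (suc j) (false ∷ u) ()
toggle-injectiveˡ (suc i) zero (true ∷ u) ()
toggle-injectiveˡ (suc i) zero (false ∷ u) ()
toggle-injectiveˡ (suc i) (suc j) (a ∷ u) e = cong suc (toggle-injectiveˡ i j u (∷-injectiveʳ e))

toggle-toggle≡id⇒≡ : ∀ {n} (i j : Fin n) (u : Vtx n) → toggle i (toggle j u) ≡ u → i ≡ j
toggle-toggle≡id⇒≡ i j u e =
  toggle-injectiveˡ i j u (trans (cong (toggle i) (sym e)) (toggle-involutive i (toggle j u)))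

-- The two vertices differ exactly in the coordinates {a} △ {b} △ {d}, a single one only when a ≡ b.
Adj-toggle²⇒≡ : ∀ {n} (a b d : Fin n) (x : Vtx n) → Adj (toggle a x) (toggle b (toggle d x)) →
                a ≢ d → b ≢ d → a ≡ b
Adj-toggle²⇒≡ zero zero d x e a≢d b≢d = refl
Adj-toggle²⇒≡ zero (suc b) zero x e a≢d b≢d = ⊥-elim (a≢d refl)
Adj-toggle²⇒≡ (suc a) zero zero x e a≢d b≢d = ⊥-elim (b≢d refl)
Adj-toggle²⇒≡ zero (suc b) (suc d) (true ∷ x) e a≢d b≢d =
  ⊥-elim (b≢d (cong suc (toggle-toggle≡id⇒≡ b d x (sym (ham≡0⇒≡ x _ (suc-injective e))))))
Adj-toggle²⇒≡ zero (suc b) (suc d) (false ∷ x) e a≢d b≢d =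
  ⊥-elim (b≢d (cong suc (toggle-toggle≡id⇒≡ b d x (sym (ham≡0⇒≡ x _ (suc-injective e))))))
Adj-toggle²⇒≡ (suc a) zero (suc d) (true ∷ x) e a≢d b≢d =
  ⊥-elim (a≢d (cong suc (toggle-injectiveˡ a d x (ham≡0⇒≡ _ _ (suc-injective e)))))
Adj-toggle²⇒≡ (suc a) zero (suc d) (false ∷ x) e a≢d b≢d =
  ⊥-elim (a≢d (cong suc (toggle-injectiveˡ a d x (ham≡0⇒≡ _ _ (suc-injective e)))))
Adj-toggle²⇒≡ (suc a) (suc b) zero (true ∷ x) e a≢d b≢d =
  cong suc (toggle-injectiveˡ a b x (ham≡0⇒≡ _ _ (suc-injective e)))
Adj-toggle²⇒≡ (suc a) (suc b) zero (false ∷ x) e a≢d b≢d =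
  cong suc (toggle-injectiveˡ a b x (ham≡0⇒≡ _ _ (suc-injective e)))
Adj-toggle²⇒≡ (suc a) (suc b) (suc d) (true ∷ x) e a≢d b≢d =
  cong suc (Adj-toggle²⇒≡ a b d x e (λ q → a≢d (cong suc q)) (λ q → b≢d (cong suc q)))
Adj-toggle²⇒≡ (suc a) (suc b) (suc d) (false ∷ x) e a≢d b≢d =
  cong suc (Adj-toggle²⇒≡ a b d x e (λ q → a≢d (cong suc q)) (λ q → b≢d (cong suc q)))

square-completion : ∀ {n} (d : Fin n) (x y z : Vtx n) → Adj x y → Adj (toggle d x) z → Adj y z →
                    y ≢ toggle d x → z ≢ x → z ≡ toggle d y
square-completion d x y z xy dxz yz y≢dx z≢x = begin
  z                       ≡⟨ z≡bdx ⟩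
  toggle b (toggle d x)   ≡⟨ cong (λ c → toggle c (toggle d x)) (sym a≡b) ⟩
  toggle a (toggle d x)   ≡⟨ toggle-comm a d x ⟩
  toggle d (toggle a x)   ≡⟨ cong (toggle d) (sym y≡ax) ⟩
  toggle d y              ∎
  where
  open ≡-Reasoning
  a = proj₁ (Adj⇒toggle x y xy)
  y≡ax = proj₂ (Adj⇒toggle x y xy)
  b = proj₁ (Adj⇒toggle (toggle d x) z dxz)
  z≡bdx = proj₂ (Adj⇒toggle (toggle d x) z dxz)
  a≡b : a ≡ b
  a≡b = Adj-toggle²⇒≡ a b d x (subst₂ Adj y≡ax z≡bdx yz)
          (λ a≡d → y≢dx (trans y≡ax (cong (λ c → toggle c x) a≡d)))
          (λ b≡d → z≢x (trans z≡bdx (trans (cong (λ c → toggle c (toggle d x)) b≡d) (toggle-involutive d x))))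

subcube-base : ∀ {n} (u M : Vtx n) → subcube u M u ≡ true
subcube-base [] [] = refl
subcube-base (true ∷ u) (true ∷ M) = subcube-base u M
subcube-base (true ∷ u) (false ∷ M) = subcube-base u M
subcube-base (false ∷ u) (true ∷ M) = subcube-base u M
subcube-base (false ∷ u) (false ∷ M) = subcube-base u M

subcube-zeros : ∀ {n} (u v : Vtx n) → subcube u zeros v ≡ true → v ≡ u
subcube-zeros [] [] e = refl
subcube-zeros (true ∷ u) (true ∷ v) e = cong (true ∷_) (subcube-zeros u v e)
subcube-zeros (false ∷ u) (false ∷ v) e = cong (false ∷_) (subcube-zeros u v e)
subcube-zeros (true ∷ u) (false ∷ v) ()
subcube-zeros (false ∷ u) (true ∷ v) ()

weight-zeros : ∀ n → weight (zeros {n}) ≡ 0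
weight-zeros zero = refl
weight-zeros (suc n) = weight-zeros n

weight-toggle : ∀ {n} (d : Fin n) (M : Vtx n) → lookup M d ≡ false → weight (toggle d M) ≡ suc (weight M)
weight-toggle zero (false ∷ M) _ = refl
weight-toggle (suc d) (true ∷ M) Md = cong suc (weight-toggle d M Md)
weight-toggle (suc d) (false ∷ M) Md = weight-toggle d M Md

lookup-toggle : ∀ {n} (d : Fin n) (v : Vtx n) → lookup (toggle d v) d ≡ not (lookup v d)
lookup-toggle zero (a ∷ v) = refl
lookup-toggle (suc d) (a ∷ v) = lookup-toggle d v

lookup-toggle-false : ∀ {n} (k : Fin n) (v : Vtx n) → lookup v k ≡ false → lookup (toggle k v) k ≡ true
lookup-toggle-false k v vk = trans (lookup-toggle k v) (cong not vk)

subcube-toggle : ∀ {n} (d : Fin n) (u M v : Vtx n) → lookup M d ≡ true →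
                 subcube u M v ≡ true → subcube u M (toggle d v) ≡ true
subcube-toggle zero (a ∷ u) (true ∷ M) (x ∷ v) _ e = e
subcube-toggle (suc d) (a ∷ u) (m ∷ M) (x ∷ v) Md e =
  ∧-true (∧-trueˡ {m ∨ x ≡ᵇ a} e) (subcube-toggle d u M v Md (∧-trueʳ {m ∨ x ≡ᵇ a} e))

subcube-extend : ∀ {n} (d : Fin n) (u M : Vtx n) → lookup M d ≡ false → subcube u M ⊆ subcube u (toggle d M)
subcube-extend zero (a ∷ u) (false ∷ M) _ (x ∷ v) e = ∧-trueʳ {x ≡ᵇ a} e
subcube-extend (suc d) (a ∷ u) (m ∷ M) Md (x ∷ v) e =
  ∧-true (∧-trueˡ {m ∨ x ≡ᵇ a} e) (subcube-extend d u M Md v (∧-trueʳ {m ∨ x ≡ᵇ a} e))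

subcube-split : ∀ {n} (d : Fin n) (u M v : Vtx n) → lookup M d ≡ false → subcube u (toggle d M) v ≡ true →
                subcube u M v ≡ true ⊎ subcube u M (toggle d v) ≡ true
subcube-split zero (true ∷ u) (false ∷ M) (true ∷ v) _ e = inj₁ e
subcube-split zero (true ∷ u) (false ∷ M) (false ∷ v) _ e = inj₂ e
subcube-split zero (false ∷ u) (false ∷ M) (true ∷ v) _ e = inj₂ e
subcube-split zero (false ∷ u) (false ∷ M) (false ∷ v) _ e = inj₁ e
subcube-split (suc d) (a ∷ u) (m ∷ M) (x ∷ v) Md e with subcube-split d u M v Md (∧-trueʳ {m ∨ x ≡ᵇ a} e)
... | inj₁ p = inj₁ (∧-true (∧-trueˡ {m ∨ x ≡ᵇ a} e) p)
... | inj₂ p = inj₂ (∧-true (∧-trueˡ {m ∨ x ≡ᵇ a} e) p)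

-- The coordinates of w ∈ Q_(weight M) fill the free directions M of the subcube, in order.
embed : ∀ {n} (u M : Vtx n) → Vtx (weight M) → Vtx n
embed [] [] w = []
embed (a ∷ u) (false ∷ M) w = a ∷ embed u M w
embed (a ∷ u) (true ∷ M) (b ∷ w) = b ∷ embed u M w

embed-∈ : ∀ {n} (u M : Vtx n) w → subcube u M (embed u M w) ≡ true
embed-∈ [] [] w = refl
embed-∈ (true ∷ u) (false ∷ M) w = embed-∈ u M w
embed-∈ (false ∷ u) (false ∷ M) w = embed-∈ u M w
embed-∈ (a ∷ u) (true ∷ M) (b ∷ w) = embed-∈ u M w

embed-onto : ∀ {n} (u M v : Vtx n) → subcube u M v ≡ true → Σ (Vtx (weight M)) λ w → embed u M w ≡ v
embed-onto [] [] [] e = [] , refl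
embed-onto (a ∷ u) (true ∷ M) (x ∷ v) e = let (w , p) = embed-onto u M v e in (x ∷ w) , cong (x ∷_) p
embed-onto (true ∷ u) (false ∷ M) (true ∷ v) e = let (w , p) = embed-onto u M v e in w , cong (true ∷_) p
embed-onto (false ∷ u) (false ∷ M) (false ∷ v) e = let (w , p) = embed-onto u M v e in w , cong (false ∷_) p
embed-onto (true ∷ u) (false ∷ M) (false ∷ v) ()
embed-onto (false ∷ u) (false ∷ M) (true ∷ v) ()

ham-embed : ∀ {n} (u M : Vtx n) a b → ham (embed u M a) (embed u M b) ≡ ham a b
ham-embed [] [] [] [] = refl
ham-embed (true ∷ u) (false ∷ M) a b = ham-embed u M a b
ham-embed (false ∷ u) (false ∷ M) a b = ham-embed u M a b
ham-embed (c ∷ u) (true ∷ M) (true ∷ a) (true ∷ b) = ham-embed u M a b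
ham-embed (c ∷ u) (true ∷ M) (true ∷ a) (false ∷ b) = cong suc (ham-embed u M a b)
ham-embed (c ∷ u) (true ∷ M) (false ∷ a) (true ∷ b) = cong suc (ham-embed u M a b)
ham-embed (c ∷ u) (true ∷ M) (false ∷ a) (false ∷ b) = ham-embed u M a b

embed-injective : ∀ {n} (u M : Vtx n) a b → embed u M a ≡ embed u M b → a ≡ b
embed-injective u M a b e =
  ham≡0⇒≡ a b (trans (sym (ham-embed u M a b)) (subst (λ z → ham (embed u M a) z ≡ 0) e (ham-refl (embed u M a))))

subcube-isoQ : ∀ {n} (u M : Vtx n) → InducedIsoQ (weight M) (subcube u M)
subcube-isoQ u M =
  embed u M , embed-∈ u M , embed-onto u M , embed-injective u M ,
  λ a b → trans (ham-embed u M a b) , trans (sym (ham-embed u M a b))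

-- Induced hypercubes are subcubes

edge-induction : ∀ {p} (P : Vtx p → Set) → P zeros → (∀ w w' → Adj w w' → P w → P w') → ∀ w → P w
edge-induction {zero} P p0 step [] = p0
edge-induction {suc p} P p0 step (b ∷ w) = lift b
  where
  P-false : ∀ w → P (false ∷ w)
  P-false = edge-induction (λ w → P (false ∷ w)) p0 (λ w w' a → step (false ∷ w) (false ∷ w') a)
  lift : ∀ b → P (b ∷ w)
  lift false = P-false w
  lift true = step (false ∷ w) (true ∷ w) (Adj-toggle zero (false ∷ w)) (P-false w)

record SubcubeImage {n p} (φ : Vtx p → Vtx n) : Set where
  field
    base dirs : Vtx n
    dim       : weight dirs ≡ p
    image⊆    : ∀ w → subcube base dirs (φ w) ≡ true
    ⊆image    : ∀ v → subcube base dirs v ≡ true → Σ (Vtx p) λ w → φ w ≡ v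

-- By induction on p: the two halves φ (false ∷ _) and φ (true ∷ _) are subcube images, and
-- square-completion shows that they are translates of each other along one direction d.
embedding-subcube : ∀ {n} p (φ : Vtx p → Vtx n) → (∀ a b → φ a ≡ φ b → a ≡ b) →
                    (∀ a b → Adj a b → Adj (φ a) (φ b)) → SubcubeImage φ
embedding-subcube {n} zero φ inj adj = record
  { base = φ [] ; dirs = zeros ; dim = weight-zeros n
  ; image⊆ = λ { [] → subcube-base (φ []) zeros }
  ; ⊆image = λ v e → [] , sym (subcube-zeros (φ []) v e) }
embedding-subcube (suc p) φ inj adj = record
  { base = base ; dirs = toggle d dirs ; dim = trans (weight-toggle d dirs d∉dirs) (cong suc dim)
  ; image⊆ = image⊆′ ; ⊆image = ⊆image′ }
  where
  φ₀ φ₁ : Vtx p → Vtx _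
  φ₀ w = φ (false ∷ w)
  φ₁ w = φ (true ∷ w)

  open SubcubeImage
    (embedding-subcube p φ₀ (λ a b e → ∷-injectiveʳ (inj _ _ e)) (λ a b → adj (false ∷ a) (false ∷ b)))

  halves-disjoint : ∀ {w w'} → φ₀ w ≢ φ₁ w'
  halves-disjoint e with inj _ _ e
  ... | ()

  edge₀ : Σ (Fin _) λ d → φ₁ zeros ≡ toggle d (φ₀ zeros)
  edge₀ = Adj⇒toggle (φ₀ zeros) (φ₁ zeros) (adj (false ∷ zeros) (true ∷ zeros) (Adj-toggle zero (false ∷ zeros {p})))

  d = proj₁ edge₀

  parallel : ∀ w → φ₁ w ≡ toggle d (φ₀ w)
  parallel = edge-induction (λ w → φ₁ w ≡ toggle d (φ₀ w)) (proj₂ edge₀) λ w w' ww' pw →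
    square-completion d (φ₀ w) (φ₀ w') (φ₁ w')
      (adj (false ∷ w) (false ∷ w') ww')
      (subst (λ z → Adj z (φ₁ w')) pw (adj (true ∷ w) (true ∷ w') ww'))
      (adj (false ∷ w') (true ∷ w') (Adj-toggle zero (false ∷ w')))
      (λ e → halves-disjoint (trans e (sym pw)))
      (λ e → halves-disjoint (sym e))

  d∉dirs : lookup dirs d ≡ false
  d∉dirs with lookup dirs d in eq
  ... | false = refl
  ... | true = ⊥-elim (halves-disjoint (trans (proj₂ hit) (sym (parallel zeros))))
    where hit = ⊆image (toggle d (φ₀ zeros)) (subcube-toggle d base dirs (φ₀ zeros) eq (image⊆ zeros))

  image⊆′ : ∀ w → subcube base (toggle d dirs) (φ w) ≡ true
  image⊆′ (false ∷ w) = subcube-extend d base dirs d∉dirs (φ₀ w) (image⊆ w)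
  image⊆′ (true ∷ w) = subst (λ z → subcube base (toggle d dirs) z ≡ true) (sym (parallel w))
    (subcube-toggle d base (toggle d dirs) (φ₀ w) (lookup-toggle-false d dirs d∉dirs)
      (subcube-extend d base dirs d∉dirs (φ₀ w) (image⊆ w)))

  ⊆image′ : ∀ v → subcube base (toggle d dirs) v ≡ true → Σ (Vtx (suc p)) λ w → φ w ≡ v
  ⊆image′ v e with subcube-split d base dirs v d∉dirs e
  ... | inj₁ q = let (w , r) = ⊆image v q in (false ∷ w) , r
  ... | inj₂ q = let (w , r) = ⊆image (toggle d v) q in
                 (true ∷ w) , trans (parallel w) (trans (cong (toggle d) r) (toggle-involutive d v))

record Subcube {n} (p : ℕ) (S : VSet n) : Set where
  field
    base dirs : Vtx n
    dim       : weight dirs ≡ p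
    ≐subcube  : S ≐ subcube base dirs

InducedIsoQ⇒Subcube : ∀ {n p} {S : VSet n} → InducedIsoQ p S → Subcube p S
InducedIsoQ⇒Subcube {p = p} {S} (φ , φ∈S , S⊆φ , inj , adj) =
  record { base = base ; dirs = dirs ; dim = dim ; ≐subcube = λ v → ≡true-ext (S⇒ v) (⇒S v) }
  where
  open SubcubeImage (embedding-subcube p φ inj (λ a b → proj₁ (adj a b)))
  S⇒ : ∀ v → S v ≡ true → subcube base dirs v ≡ true
  S⇒ v e = let (w , φw≡v) = S⊆φ v e in subst (λ z → subcube base dirs z ≡ true) φw≡v (image⊆ w)
  ⇒S : ∀ v → subcube base dirs v ≡ true → S v ≡ true
  ⇒S v e = let (w , φw≡v) = ⊆image v e in subst (λ z → S z ≡ true) φw≡v (φ∈S w)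

⊑-refl : ∀ {n} (x : Vtx n) → x ⊑ᵇ x ≡ true
⊑-refl [] = refl
⊑-refl (true ∷ x) = ⊑-refl x
⊑-refl (false ∷ x) = ⊑-refl x

⊑-antisym : ∀ {n} (x y : Vtx n) → x ⊑ᵇ y ≡ true → y ⊑ᵇ x ≡ true → x ≡ y
⊑-antisym [] [] _ _ = refl
⊑-antisym (true ∷ x) (true ∷ y) e f = cong (true ∷_) (⊑-antisym x y e f)
⊑-antisym (false ∷ x) (false ∷ y) e f = cong (false ∷_) (⊑-antisym x y e f)
⊑-antisym (true ∷ x) (false ∷ y) () f
⊑-antisym (false ∷ x) (true ∷ y) e ()

⊑-lookup : ∀ {n} (x y : Vtx n) (k : Fin n) → x ⊑ᵇ y ≡ true → lookup x k ≡ true → lookup y k ≡ true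
⊑-lookup (true ∷ x) (true ∷ y) zero e _ = refl
⊑-lookup (true ∷ x) (false ∷ y) zero () _
⊑-lookup (a ∷ x) (b ∷ y) (suc k) e l = ⊑-lookup x y k (∧-trueʳ {a ≤ᵇ b} e) l

⋢⇒witness : ∀ {n} (x y : Vtx n) → x ⊑ᵇ y ≡ false → Σ (Fin n) λ k → lookup x k ≡ true × lookup y k ≡ false
⋢⇒witness [] [] ()
⋢⇒witness (true ∷ x) (false ∷ y) e = zero , refl , refl
⋢⇒witness (true ∷ x) (true ∷ y) e = let (k , p , q) = ⋢⇒witness x y e in suc k , p , q
⋢⇒witness (false ∷ x) (b ∷ y) e = let (k , p , q) = ⋢⇒witness x y e in suc k , p , q

⊑⇒weight≤ : ∀ {n} (x y : Vtx n) → x ⊑ᵇ y ≡ true → weight x ≤ weight y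
⊑⇒weight≤ [] [] _ = z≤n
⊑⇒weight≤ (true ∷ x) (true ∷ y) e = s≤s (⊑⇒weight≤ x y e)
⊑⇒weight≤ (false ∷ x) (true ∷ y) e = m≤n⇒m≤1+n (⊑⇒weight≤ x y e)
⊑⇒weight≤ (false ∷ x) (false ∷ y) e = ⊑⇒weight≤ x y e

toggle-⊑ : ∀ {n} (j : Fin n) (M : Vtx n) → lookup M j ≡ true → toggle j M ⊑ᵇ M ≡ true
toggle-⊑ zero (true ∷ M) _ = ⊑-refl M
toggle-⊑ (suc j) (true ∷ M) e = toggle-⊑ j M e
toggle-⊑ (suc j) (false ∷ M) e = toggle-⊑ j M e

zeros-⊑ : ∀ {n} (x : Vtx n) → zeros ⊑ᵇ x ≡ true
zeros-⊑ [] = refl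
zeros-⊑ (a ∷ x) = zeros-⊑ x

≤ᵇ-∨ʳ : ∀ a m → m ≤ᵇ (a ∨ m) ≡ true
≤ᵇ-∨ʳ a true = ∨-zeroʳ a
≤ᵇ-∨ʳ a false = refl

infixr 8 _∨ᵛ_

_∨ᵛ_ : ∀ {n} → Vtx n → Vtx n → Vtx n
_∨ᵛ_ = zipWith _∨_

⊑-∨ᵛˡ : ∀ {n} (u M : Vtx n) → u ⊑ᵇ u ∨ᵛ M ≡ true
⊑-∨ᵛˡ [] [] = refl
⊑-∨ᵛˡ (true ∷ u) (m ∷ M) = ⊑-∨ᵛˡ u M
⊑-∨ᵛˡ (false ∷ u) (m ∷ M) = ⊑-∨ᵛˡ u M

⊑-∨ᵛʳ : ∀ {n} (u M : Vtx n) → M ⊑ᵇ u ∨ᵛ M ≡ true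
⊑-∨ᵛʳ [] [] = refl
⊑-∨ᵛʳ (a ∷ u) (m ∷ M) = ∧-true (≤ᵇ-∨ʳ a m) (⊑-∨ᵛʳ u M)

toggle-⊑-∨ᵛ : ∀ {n} (k : Fin n) (u M : Vtx n) → lookup u k ≡ true → lookup M k ≡ false →
              toggle k M ⊑ᵇ u ∨ᵛ M ≡ true
toggle-⊑-∨ᵛ zero (true ∷ u) (false ∷ M) _ _ = ⊑-∨ᵛʳ u M
toggle-⊑-∨ᵛ (suc k) (a ∷ u) (m ∷ M) uk Mk = ∧-true (≤ᵇ-∨ʳ a m) (toggle-⊑-∨ᵛ k u M uk Mk)

∨ᵛ-∈subcube : ∀ {n} (u M : Vtx n) → subcube u M (u ∨ᵛ M) ≡ true
∨ᵛ-∈subcube [] [] = refl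
∨ᵛ-∈subcube (a ∷ u) (true ∷ M) = ∨ᵛ-∈subcube u M
∨ᵛ-∈subcube (true ∷ u) (false ∷ M) = ∨ᵛ-∈subcube u M
∨ᵛ-∈subcube (false ∷ u) (false ∷ M) = ∨ᵛ-∈subcube u M

downset≡⊑ : ∀ {n} (t v : Vtx n) → downset t v ≡ v ⊑ᵇ t
downset≡⊑ [] [] = refl
downset≡⊑ (true ∷ t) (true ∷ v) = downset≡⊑ t v
downset≡⊑ (true ∷ t) (false ∷ v) = downset≡⊑ t v
downset≡⊑ (false ∷ t) (true ∷ v) = refl
downset≡⊑ (false ∷ t) (false ∷ v) = downset≡⊑ t v

downset-self : ∀ {n} (t : Vtx n) → downset t t ≡ true
downset-self t = trans (downset≡⊑ t t) (⊑-refl t)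

downset-injective : ∀ {n} (t t' : Vtx n) → downset t ≐ downset t' → t ≡ t'
downset-injective t t' e = ⊑-antisym t t'
  (trans (sym (downset≡⊑ t' t)) (trans (sym (e t)) (downset-self t)))
  (trans (sym (downset≡⊑ t t')) (trans (e t') (downset-self t')))

subcube-⊑-base : ∀ {n} (u M : Vtx n) → u ⊑ᵇ M ≡ true → subcube u M ≐ downset M
subcube-⊑-base [] [] _ [] = refl
subcube-⊑-base (true ∷ u) (true ∷ M) e (x ∷ v) = subcube-⊑-base u M e v
subcube-⊑-base (false ∷ u) (true ∷ M) e (x ∷ v) = subcube-⊑-base u M e v
subcube-⊑-base (false ∷ u) (false ∷ M) e (x ∷ v) = cong (x ≡ᵇ false ∧_) (subcube-⊑-base u M e v)

subcube-⊑ : ∀ {n} (u N v X : Vtx n) → subcube u N v ≡ true → N ⊑ᵇ X ≡ true → u ⊑ᵇ X ≡ true →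
            v ⊑ᵇ X ≡ true
subcube-⊑ [] [] [] [] _ _ _ = refl
subcube-⊑ (a ∷ u) (true ∷ N) (x ∷ v) (true ∷ X) e f g =
  ∧-true (∨-zeroʳ (not x)) (subcube-⊑ u N v X e f (∧-trueʳ {a ≤ᵇ true} g))
subcube-⊑ (true ∷ u) (false ∷ N) (true ∷ v) (c ∷ X) e f g =
  ∧-true (∧-trueˡ {true ≤ᵇ c} g) (subcube-⊑ u N v X e f (∧-trueʳ {true ≤ᵇ c} g))
subcube-⊑ (false ∷ u) (false ∷ N) (false ∷ v) (c ∷ X) e f g = subcube-⊑ u N v X e f g
subcube-⊑ (true ∷ u) (false ∷ N) (false ∷ v) (c ∷ X) () f g
subcube-⊑ (false ∷ u) (false ∷ N) (true ∷ v) (c ∷ X) () f g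

headOr : ∀ {n} → Vtx n → Bool → Bool
headOr [] r = r
headOr (x ∷ _) r = x

noConsecBetween : ∀ {n} → Bool → Vtx n → Bool → Bool
noConsecBetween l [] r = not (l ∧ r)
noConsecBetween l (x ∷ w) r = not (l ∧ x) ∧ noConsecBetween x w r

-- Moreover every zero of w has a one next to it, so no bit of w can be raised.
maximalBetween : ∀ {n} → Bool → Vtx n → Bool → Bool
maximalBetween l [] r = not (l ∧ r)
maximalBetween l (x ∷ w) r = not (l ∧ x) ∧ (x ∨ l ∨ headOr w r) ∧ maximalBetween x w r

-- Maximal independent sets of the n-cycle, read off cyclically.  Only meaningful for n ≥ 2:
-- the single vertices of Λ₀ and Λ₁ are treated separately.
isMaxLucas : ∀ {n} → Vtx n → Bool
isMaxLucas [] = false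
isMaxLucas (a ∷ w) = maximalBetween a w a ∧ (a ∨ headOr w a ∨ lastB (a ∷ w))

Saturated : ∀ {n} → Vtx n → Set
Saturated t = ∀ v → isLucas v ≡ true → Adj t v → v ⊑ᵇ t ≡ true

Adj-∷ : ∀ {n} a {u v : Vtx n} → Adj u v → Adj (a ∷ u) (a ∷ v)
Adj-∷ true h = h
Adj-∷ false h = h

⋢-∷ : ∀ {n} a {u v : Vtx n} → u ⊑ᵇ v ≡ false → (a ∷ u) ⊑ᵇ (a ∷ v) ≡ false
⋢-∷ true h = h
⋢-∷ false h = h

noConsec∧lastB≡noConsecBetween : ∀ {n} l (w : Vtx n) r →
                                 noConsec (l ∷ w) ∧ not (lastB (l ∷ w) ∧ r) ≡ noConsecBetween l w r
noConsec∧lastB≡noConsecBetween l [] r = refl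
noConsec∧lastB≡noConsecBetween l (x ∷ w) r =
  trans (∧-assoc (not (l ∧ x)) (noConsec (x ∷ w)) _) (cong (not (l ∧ x) ∧_) (noConsec∧lastB≡noConsecBetween x w r))

isLucas≡noConsecBetween : ∀ {n} a (w : Vtx n) → isLucas (a ∷ w) ≡ noConsecBetween a w a
isLucas≡noConsecBetween a w =
  trans (cong (λ q → noConsec (a ∷ w) ∧ not q) (∧-comm a (lastB (a ∷ w)))) (noConsec∧lastB≡noConsecBetween a w a)

nand-antitone : ∀ l l' r r' → l' ≤ᵇ l ≡ true → r' ≤ᵇ r ≡ true →
                not (l ∧ r) ≡ true → not (l' ∧ r') ≡ true
nand-antitone l false r r' _ _ _ = refl
nand-antitone l true r false _ _ _ = refl
nand-antitone true true true true _ _ ()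
nand-antitone false true r true () _ _
nand-antitone true true false true _ () _

noConsecBetween-antitone : ∀ {n} l l' r r' (w v : Vtx n) →
                           l' ≤ᵇ l ≡ true → r' ≤ᵇ r ≡ true → v ⊑ᵇ w ≡ true →
                           noConsecBetween l w r ≡ true → noConsecBetween l' v r' ≡ true
noConsecBetween-antitone l l' r r' [] [] l'≤l r'≤r _ e = nand-antitone l l' r r' l'≤l r'≤r e
noConsecBetween-antitone l l' r r' (x ∷ w) (y ∷ v) l'≤l r'≤r v⊑w e =
  ∧-true (nand-antitone l l' x y l'≤l (∧-trueˡ {y ≤ᵇ x} v⊑w) (∧-trueˡ {not (l ∧ x)} e))
         (noConsecBetween-antitone x y r r' w v (∧-trueˡ {y ≤ᵇ x} v⊑w) r'≤r (∧-trueʳ {y ≤ᵇ x} v⊑w)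
            (∧-trueʳ {not (l ∧ x)} e))

isLucas-⊑ : ∀ {n} (v t : Vtx n) → v ⊑ᵇ t ≡ true → isLucas t ≡ true → isLucas v ≡ true
isLucas-⊑ [] [] _ _ = refl
isLucas-⊑ (b ∷ v) (a ∷ t) s e =
  trans (isLucas≡noConsecBetween b v)
    (noConsecBetween-antitone a b a b t v (∧-trueˡ {b ≤ᵇ a} s) (∧-trueˡ {b ≤ᵇ a} s) (∧-trueʳ {b ≤ᵇ a} s)
      (trans (sym (isLucas≡noConsecBetween a t)) e))

maximalBetween⇒noConsecBetween : ∀ {n} l (w : Vtx n) r → maximalBetween l w r ≡ true → noConsecBetween l w r ≡ true
maximalBetween⇒noConsecBetween l [] r e = e
maximalBetween⇒noConsecBetween l (x ∷ w) r e =
  ∧-true (∧-trueˡ {not (l ∧ x)} e)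
         (maximalBetween⇒noConsecBetween x w r (∧-trueʳ {x ∨ l ∨ headOr w r} (∧-trueʳ {not (l ∧ x)} e)))

isMaxLucas⇒isLucas : ∀ {n} a (w : Vtx n) → isMaxLucas (a ∷ w) ≡ true → isLucas (a ∷ w) ≡ true
isMaxLucas⇒isLucas a w e =
  trans (isLucas≡noConsecBetween a w) (maximalBetween⇒noConsecBetween a w a (∧-trueˡ {maximalBetween a w a} e))

noConsecBetween-true-headOr : ∀ {n} (w : Vtx n) r → noConsecBetween true w r ≡ true → headOr w r ≡ false
noConsecBetween-true-headOr [] false e = refl
noConsecBetween-true-headOr [] true ()
noConsecBetween-true-headOr (false ∷ w) r e = refl
noConsecBetween-true-headOr (true ∷ w) r ()

maximalBetween-Adj⇒⊑ : ∀ {n} l r (w w' : Vtx n) → maximalBetween l w r ≡ true → noConsecBetween l w' r ≡ true →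
                       Adj w w' → w' ⊑ᵇ w ≡ true
maximalBetween-Adj⇒⊑ l r [] [] _ _ ()
maximalBetween-Adj⇒⊑ l r (true ∷ w) (true ∷ w') c n h =
  maximalBetween-Adj⇒⊑ true r w w' (∧-trueʳ {true ∨ l ∨ headOr w r} (∧-trueʳ {not (l ∧ true)} c))
    (∧-trueʳ {not (l ∧ true)} n) h
maximalBetween-Adj⇒⊑ l r (false ∷ w) (false ∷ w') c n h =
  maximalBetween-Adj⇒⊑ false r w w' (∧-trueʳ {false ∨ l ∨ headOr w r} (∧-trueʳ {not (l ∧ false)} c))
    (∧-trueʳ {not (l ∧ false)} n) h
maximalBetween-Adj⇒⊑ l r (true ∷ w) (false ∷ w') c n h =
  subst (λ q → q ⊑ᵇ w ≡ true) (ham≡0⇒≡ w w' (suc-injective h)) (⊑-refl w)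
maximalBetween-Adj⇒⊑ true r (false ∷ w) (true ∷ w') c () h
maximalBetween-Adj⇒⊑ false r (false ∷ w) (true ∷ w') c n h =
  ⊥-elim (true≢false (trans (sym (∧-trueˡ {headOr w r} c))
    (subst (λ q → headOr q r ≡ false) (sym (ham≡0⇒≡ w w' (suc-injective h))) (noConsecBetween-true-headOr w' r n))))

isMaxLucas⇒Saturated : ∀ {n} a x (w : Vtx n) → isMaxLucas (a ∷ x ∷ w) ≡ true → Saturated (a ∷ x ∷ w)
isMaxLucas⇒Saturated a x w e (b ∷ v) lv h with a | b
... | true | true =
  maximalBetween-Adj⇒⊑ true true (x ∷ w) v (∧-trueˡ {maximalBetween true (x ∷ w) true} e)
    (trans (sym (isLucas≡noConsecBetween true v)) lv) h
... | false | false =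
  maximalBetween-Adj⇒⊑ false false (x ∷ w) v (∧-trueˡ {maximalBetween false (x ∷ w) false} e)
    (trans (sym (isLucas≡noConsecBetween false v)) lv) h
... | true | false = subst (λ q → q ⊑ᵇ (x ∷ w) ≡ true) (ham≡0⇒≡ (x ∷ w) v (suc-injective h)) (⊑-refl (x ∷ w))
... | false | true =
  -- v raises the first bit, so both of its cyclic neighbours x and lastB (x ∷ w) are zero.
  ⊥-elim (true≢false (trans (sym (∧-trueʳ {maximalBetween false (x ∷ w) false} e))
    (firstBitFree x (noConsecBetween-true-headOr (x ∷ w) true noConsec1xw1) lastB≢1)))
  where
  xw≡v = ham≡0⇒≡ (x ∷ w) v (suc-injective h)
  noConsec1xw1 : noConsecBetween true (x ∷ w) true ≡ true
  noConsec1xw1 = trans (sym (isLucas≡noConsecBetween true (x ∷ w)))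
                       (subst (λ q → isLucas (true ∷ q) ≡ true) (sym xw≡v) lv)
  lastB≢1 : not (lastB (x ∷ w) ∧ true) ≡ true
  lastB≢1 = ∧-trueʳ {noConsec (true ∷ x ∷ w)} (trans (noConsec∧lastB≡noConsecBetween true (x ∷ w) true) noConsec1xw1)
  firstBitFree : ∀ x → x ≡ false → not (lastB (x ∷ w) ∧ true) ≡ true → (false ∨ x ∨ lastB (x ∷ w)) ≡ false
  firstBitFree false refl nl with lastB (false ∷ w)
  ... | false = refl
  ... | true = ⊥-elim (true≢false (sym nl))

noConsecBetween-raiseˡ : ∀ {n} (w : Vtx n) r → noConsecBetween false w r ≡ true → headOr w r ≡ false →
                         noConsecBetween true w r ≡ true
noConsecBetween-raiseˡ [] false e refl = refl
noConsecBetween-raiseˡ (false ∷ w) r e refl = e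

noConsecBetween-raiseʳ : ∀ {n} l (w : Vtx n) → noConsecBetween l w false ≡ true → lastB (l ∷ w) ≡ false →
                         noConsecBetween l w true ≡ true
noConsecBetween-raiseʳ false [] e refl = refl
noConsecBetween-raiseʳ l (y ∷ w) e lb =
  ∧-true (∧-trueˡ {not (l ∧ y)} e) (noConsecBetween-raiseʳ y w (∧-trueʳ {not (l ∧ y)} e) lb)

¬maximalBetween⇒raisable : ∀ {n} l r (w : Vtx n) → noConsecBetween l w r ≡ true → maximalBetween l w r ≡ false →
                           Σ (Vtx n) λ w' → noConsecBetween l w' r ≡ true × Adj w w' × w' ⊑ᵇ w ≡ false
¬maximalBetween⇒raisable l r [] e f = ⊥-elim (true≢false (trans (sym e) f))
¬maximalBetween⇒raisable true r (true ∷ w) () f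
¬maximalBetween⇒raisable true r (false ∷ w) e f =
  let (w' , a , b , c) = ¬maximalBetween⇒raisable false r w e f in (false ∷ w') , a , b , c
¬maximalBetween⇒raisable false r (true ∷ w) e f =
  let (w' , a , b , c) = ¬maximalBetween⇒raisable true r w e f in (true ∷ w') , a , b , c
¬maximalBetween⇒raisable false r (false ∷ w) e f with headOr w r in eq
... | true = let (w' , a , b , c) = ¬maximalBetween⇒raisable false r w e f in (false ∷ w') , a , b , c
... | false = (true ∷ w) , noConsecBetween-raiseˡ w r e eq , Adj-toggle zero (false ∷ w) , refl

¬isMaxLucas⇒¬Saturated : ∀ {n} a x (w : Vtx n) → isLucas (a ∷ x ∷ w) ≡ true → isMaxLucas (a ∷ x ∷ w) ≡ false →
                         ¬ Saturated (a ∷ x ∷ w)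
¬isMaxLucas⇒¬Saturated a x w lu lm sat with maximalBetween a (x ∷ w) a in eq
... | false =
  let (w' , p , q , r) = ¬maximalBetween⇒raisable a a (x ∷ w) (trans (sym (isLucas≡noConsecBetween a (x ∷ w))) lu) eq
  in true≢false (trans (sym (sat (a ∷ w') (trans (isLucas≡noConsecBetween a w') p) (Adj-∷ a q))) (⋢-∷ a {w'} {x ∷ w} r))
... | true with a | x
...   | true | _ = case lm of λ ()
...   | false | true = case lm of λ ()
...   | false | false = true≢false (sym (sat (true ∷ false ∷ w) lucas (Adj-toggle zero (false ∷ false ∷ w))))
  where
  lucas = trans (isLucas≡noConsecBetween true (false ∷ w))
    (noConsecBetween-raiseʳ false w (trans (sym (isLucas≡noConsecBetween false (false ∷ w))) lu) lm)

Saturated⇒isMaxLucas : ∀ {n} a x (w : Vtx n) → isLucas (a ∷ x ∷ w) ≡ true → Saturated (a ∷ x ∷ w) →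
                       isMaxLucas (a ∷ x ∷ w) ≡ true
Saturated⇒isMaxLucas a x w lu sat with isMaxLucas (a ∷ x ∷ w) in eq
... | true = refl
... | false = ⊥-elim (¬isMaxLucas⇒¬Saturated a x w lu eq sat)

-- Maximal hypercubes of Λ_n are the downsets of saturated Lucas strings

subcube-isHypercube : ∀ {n} (u M X : Vtx n) → u ⊑ᵇ X ≡ true → M ⊑ᵇ X ≡ true → isLucas X ≡ true →
                      IsHypercube n (weight M) (subcube u M)
subcube-isHypercube u M X u⊑X M⊑X lucX =
  (λ v v∈ → isLucas-⊑ v X (subcube-⊑ u M v X v∈ M⊑X u⊑X) lucX) , subcube-isoQ u M

downset-isHypercube : ∀ {n} (t : Vtx n) → isLucas t ≡ true → IsHypercube n (weight t) (downset t)
downset-isHypercube t = subcube-isHypercube zeros t t (zeros-⊑ t) (⊑-refl t)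

downset-isMaxHypercube : ∀ {n p} (t : Vtx n) → isLucas t ≡ true → Saturated t → weight t ≡ p →
                         IsMaxHypercube n p (downset t)
downset-isMaxHypercube {n} t lu sat refl = downset-isHypercube t lu , maximal
  where
  maximal : ∀ T → IsHypercube n (suc (weight t)) T → ¬ (downset t ⊆ T)
  maximal T (lucT , isoT) t⊆T with InducedIsoQ⇒Subcube isoT
  ... | record { base = u ; dirs = M ; dim = dim ; ≐subcube = T≐ } with M ⊑ᵇ t in M⊑t
  ... | true = <-irrefl refl (subst (_≤ weight t) dim (⊑⇒weight≤ M t M⊑t))
  ... | false = true≢false (trans (sym (⊑-lookup (toggle k t) t k raised⊑t (lookup-toggle-false k t tk))) tk)
    where
    k = proj₁ (⋢⇒witness M t M⊑t)
    Mk = proj₁ (proj₂ (⋢⇒witness M t M⊑t))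
    tk = proj₂ (proj₂ (⋢⇒witness M t M⊑t))
    raised∈T : T (toggle k t) ≡ true
    raised∈T = trans (T≐ _) (subcube-toggle k u M t Mk (trans (sym (T≐ t)) (t⊆T t (downset-self t))))
    raised⊑t : toggle k t ⊑ᵇ t ≡ true
    raised⊑t = sat (toggle k t) (lucT _ raised∈T) (Adj-toggle k t)

-- If the base u has a one outside the directions M, the subcube widens along it while staying below
-- the Lucas string u ∨ᵛ M.  Otherwise S is the downset of M, and a Lucas neighbour above M would
-- again give a wider cube.
isMaxHypercube⇒downset : ∀ {n p} (S : VSet n) → IsMaxHypercube n p S →
                         Σ (Vtx n) λ t → isLucas t ≡ true × Saturated t × weight t ≡ p × downset t ≐ S
isMaxHypercube⇒downset {n} {p} S ((lucS , isoS) , maxS) with InducedIsoQ⇒Subcube isoS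
... | record { base = u ; dirs = M ; dim = dim ; ≐subcube = S≐ } with u ⊑ᵇ M in u⊑M
... | false = ⊥-elim (maxS (subcube u (toggle k M)) widerCube S⊆widerCube)
  where
  k = proj₁ (⋢⇒witness u M u⊑M)
  uk = proj₁ (proj₂ (⋢⇒witness u M u⊑M))
  Mk = proj₂ (proj₂ (⋢⇒witness u M u⊑M))
  widerCube : IsHypercube n (suc p) (subcube u (toggle k M))
  widerCube = subst (λ q → IsHypercube n q (subcube u (toggle k M))) (trans (weight-toggle k M Mk) (cong suc dim))
    (subcube-isHypercube u (toggle k M) (u ∨ᵛ M) (⊑-∨ᵛˡ u M) (toggle-⊑-∨ᵛ k u M uk Mk)
      (lucS _ (trans (S≐ _) (∨ᵛ-∈subcube u M))))
  S⊆widerCube : S ⊆ subcube u (toggle k M)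
  S⊆widerCube v e = subcube-extend k u M Mk v (trans (sym (S≐ v)) e)
... | true = M , lucM , satM , dim , λ v → sym (S≐↓M v)
  where
  S≐↓M : S ≐ downset M
  S≐↓M v = trans (S≐ v) (subcube-⊑-base u M u⊑M v)
  lucM : isLucas M ≡ true
  lucM = lucS M (trans (S≐↓M M) (downset-self M))
  satM : Saturated M
  satM v lv Mv with v ⊑ᵇ M in v⊑M | Adj⇒toggle M v Mv
  ... | true | _ = refl
  ... | false | j , refl with lookup M j in Mj
  ...   | true = ⊥-elim (true≢false (trans (sym (toggle-⊑ j M Mj)) v⊑M))
  ...   | false = ⊥-elim (maxS (downset (toggle j M)) widerCube S⊆widerCube)
    where
    widerCube : IsHypercube n (suc p) (downset (toggle j M))
    widerCube = subst (λ q → IsHypercube n q (downset (toggle j M))) (trans (weight-toggle j M Mj) (cong suc dim))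
      (downset-isHypercube (toggle j M) lv)
    S⊆widerCube : S ⊆ downset (toggle j M)
    S⊆widerCube x e = subcube-extend j zeros M Mj x (trans (sym (S≐↓M x)) e)

-- Enumeration of the saturated Lucas strings

-- Insert 10 (resp. 100) in front of the first one.  A maximal Lucas string has a one among
-- its first three bits, so the last clause only matters for totality.
grow₂ : ∀ {m} → Vtx m → Vtx (2 + m)
grow₂ (true ∷ r) = true ∷ false ∷ true ∷ r
grow₂ (false ∷ true ∷ r) = false ∷ true ∷ false ∷ true ∷ r
grow₂ (false ∷ false ∷ true ∷ r) = false ∷ false ∷ true ∷ false ∷ true ∷ r
grow₂ t = false ∷ false ∷ t

grow₃ : ∀ {m} → Vtx m → Vtx (3 + m)
grow₃ (true ∷ r) = true ∷ false ∷ false ∷ true ∷ r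
grow₃ (false ∷ true ∷ r) = false ∷ true ∷ false ∷ false ∷ true ∷ r
grow₃ (false ∷ false ∷ true ∷ r) = false ∷ false ∷ true ∷ false ∷ false ∷ true ∷ r
grow₃ t = false ∷ false ∷ false ∷ t

shrink₂ : ∀ {m} → Vtx (2 + m) → Vtx m
shrink₂ (true ∷ false ∷ x) = x
shrink₂ (false ∷ true ∷ false ∷ x) = false ∷ x
shrink₂ (false ∷ false ∷ true ∷ false ∷ x) = false ∷ false ∷ x
shrink₂ (_ ∷ _ ∷ v) = v

shrink₃ : ∀ {m} → Vtx (3 + m) → Vtx m
shrink₃ (true ∷ false ∷ false ∷ x) = x
shrink₃ (false ∷ true ∷ false ∷ false ∷ x) = false ∷ x
shrink₃ (false ∷ false ∷ true ∷ false ∷ false ∷ x) = false ∷ false ∷ x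
shrink₃ (_ ∷ _ ∷ _ ∷ v) = v

shrink₂-grow₂ : ∀ {m} (t : Vtx m) → shrink₂ (grow₂ t) ≡ t
shrink₂-grow₂ (true ∷ r) = refl
shrink₂-grow₂ (false ∷ true ∷ r) = refl
shrink₂-grow₂ (false ∷ false ∷ true ∷ r) = refl
shrink₂-grow₂ [] = refl
shrink₂-grow₂ (false ∷ []) = refl
shrink₂-grow₂ (false ∷ false ∷ []) = refl
shrink₂-grow₂ (false ∷ false ∷ false ∷ r) = refl

shrink₃-grow₃ : ∀ {m} (t : Vtx m) → shrink₃ (grow₃ t) ≡ t
shrink₃-grow₃ (true ∷ r) = refl
shrink₃-grow₃ (false ∷ true ∷ r) = refl
shrink₃-grow₃ (false ∷ false ∷ true ∷ r) = refl
shrink₃-grow₃ [] = refl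
shrink₃-grow₃ (false ∷ []) = refl
shrink₃-grow₃ (false ∷ false ∷ []) = refl
shrink₃-grow₃ (false ∷ false ∷ false ∷ r) = refl

maxLucasStrings : (n p : ℕ) → List (Vtx n)
maxLucasStrings 0 0 = [] ∷ []
maxLucasStrings 1 0 = (false ∷ []) ∷ []
maxLucasStrings 2 1 = (true ∷ false ∷ []) ∷ (false ∷ true ∷ []) ∷ []
maxLucasStrings 3 1 =
  (true ∷ false ∷ false ∷ []) ∷ (false ∷ true ∷ false ∷ []) ∷ (false ∷ false ∷ true ∷ []) ∷ []
maxLucasStrings 4 2 = (true ∷ false ∷ true ∷ false ∷ []) ∷ (false ∷ true ∷ false ∷ true ∷ []) ∷ []
maxLucasStrings (suc (suc (suc (suc (suc k))))) (suc p) =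
  map grow₂ (maxLucasStrings (3 + k) p) ++ map grow₃ (maxLucasStrings (2 + k) p)
maxLucasStrings _ _ = []

isMaxLucas-grow₂-001 : ∀ {m} (r : Vtx m) →
                       isMaxLucas (grow₂ (false ∷ false ∷ true ∷ r)) ≡ isMaxLucas (false ∷ false ∷ true ∷ r)
isMaxLucas-grow₂-001 [] = refl
isMaxLucas-grow₂-001 (y ∷ r) = refl

isMaxLucas-grow₃-001 : ∀ {m} (r : Vtx m) →
                       isMaxLucas (grow₃ (false ∷ false ∷ true ∷ r)) ≡ isMaxLucas (false ∷ false ∷ true ∷ r)
isMaxLucas-grow₃-001 [] = refl
isMaxLucas-grow₃-001 (y ∷ r) = refl

isMaxLucas-grow₂ : ∀ {m} (t : Vtx m) → isMaxLucas t ≡ true → isMaxLucas (grow₂ t) ≡ true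
isMaxLucas-grow₂ (true ∷ r) e = e
isMaxLucas-grow₂ (false ∷ true ∷ r) e = e
isMaxLucas-grow₂ (false ∷ false ∷ true ∷ r) e = trans (isMaxLucas-grow₂-001 r) e
isMaxLucas-grow₂ [] ()
isMaxLucas-grow₂ (false ∷ []) ()
isMaxLucas-grow₂ (false ∷ false ∷ []) ()
isMaxLucas-grow₂ (false ∷ false ∷ false ∷ r) ()

isMaxLucas-grow₃ : ∀ {m} (t : Vtx m) → isMaxLucas t ≡ true → isMaxLucas (grow₃ t) ≡ true
isMaxLucas-grow₃ (true ∷ r) e = e
isMaxLucas-grow₃ (false ∷ true ∷ r) e = e
isMaxLucas-grow₃ (false ∷ false ∷ true ∷ r) e = trans (isMaxLucas-grow₃-001 r) e
isMaxLucas-grow₃ [] ()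
isMaxLucas-grow₃ (false ∷ []) ()
isMaxLucas-grow₃ (false ∷ false ∷ []) ()
isMaxLucas-grow₃ (false ∷ false ∷ false ∷ r) ()

weight-grow₂ : ∀ {m} (t : Vtx m) → isMaxLucas t ≡ true → weight (grow₂ t) ≡ suc (weight t)
weight-grow₂ (true ∷ r) e = refl
weight-grow₂ (false ∷ true ∷ r) e = refl
weight-grow₂ (false ∷ false ∷ true ∷ r) e = refl
weight-grow₂ [] ()
weight-grow₂ (false ∷ []) ()
weight-grow₂ (false ∷ false ∷ []) ()
weight-grow₂ (false ∷ false ∷ false ∷ r) ()

weight-grow₃ : ∀ {m} (t : Vtx m) → isMaxLucas t ≡ true → weight (grow₃ t) ≡ suc (weight t)
weight-grow₃ (true ∷ r) e = refl
weight-grow₃ (false ∷ true ∷ r) e = refl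
weight-grow₃ (false ∷ false ∷ true ∷ r) e = refl
weight-grow₃ [] ()
weight-grow₃ (false ∷ []) ()
weight-grow₃ (false ∷ false ∷ []) ()
weight-grow₃ (false ∷ false ∷ false ∷ r) ()

MaxLucasOfWeight : ∀ {n} → ℕ → Vtx n → Set
MaxLucasOfWeight p t = isMaxLucas t ≡ true × weight t ≡ p

maxLucasStrings-isMaxLucas : ∀ k p → All (MaxLucasOfWeight p) (maxLucasStrings (2 + k) p)
maxLucasStrings-isMaxLucas 0 1 = (refl , refl) ∷ (refl , refl) ∷ []
maxLucasStrings-isMaxLucas 1 1 = (refl , refl) ∷ (refl , refl) ∷ (refl , refl) ∷ []
maxLucasStrings-isMaxLucas 2 2 = (refl , refl) ∷ (refl , refl) ∷ []
maxLucasStrings-isMaxLucas (suc (suc (suc j))) (suc p) =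
  All.++⁺ (All.map⁺ {f = grow₂} (All.map (λ {t} → grown₂ {t}) (maxLucasStrings-isMaxLucas (suc j) p)))
          (All.map⁺ {f = grow₃} (All.map (λ {t} → grown₃ {t}) (maxLucasStrings-isMaxLucas j p)))
  where
  grown₂ : ∀ {t : Vtx (3 + j)} → MaxLucasOfWeight p t → MaxLucasOfWeight (suc p) (grow₂ t)
  grown₂ {t} (e , refl) = isMaxLucas-grow₂ t e , weight-grow₂ t e
  grown₃ : ∀ {t : Vtx (2 + j)} → MaxLucasOfWeight p t → MaxLucasOfWeight (suc p) (grow₃ t)
  grown₃ {t} (e , refl) = isMaxLucas-grow₃ t e , weight-grow₃ t e
maxLucasStrings-isMaxLucas 0 0 = []
maxLucasStrings-isMaxLucas 0 (suc (suc p)) = []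
maxLucasStrings-isMaxLucas 1 0 = []
maxLucasStrings-isMaxLucas 1 (suc (suc p)) = []
maxLucasStrings-isMaxLucas 2 0 = []
maxLucasStrings-isMaxLucas 2 1 = []
maxLucasStrings-isMaxLucas 2 (suc (suc (suc p))) = []
maxLucasStrings-isMaxLucas (suc (suc (suc j))) 0 = []

isMaxLucas⇒∈maxLucasStrings₂ : ∀ (t : Vtx 2) → isMaxLucas t ≡ true → t ∈ maxLucasStrings 2 (weight t)
isMaxLucas⇒∈maxLucasStrings₂ (true ∷ true ∷ []) ()
isMaxLucas⇒∈maxLucasStrings₂ (true ∷ false ∷ []) e = here refl
isMaxLucas⇒∈maxLucasStrings₂ (false ∷ true ∷ []) e = there (here refl)
isMaxLucas⇒∈maxLucasStrings₂ (false ∷ false ∷ []) ()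

isMaxLucas⇒∈maxLucasStrings₃ : ∀ (t : Vtx 3) → isMaxLucas t ≡ true → t ∈ maxLucasStrings 3 (weight t)
isMaxLucas⇒∈maxLucasStrings₃ (true ∷ true ∷ true ∷ []) ()
isMaxLucas⇒∈maxLucasStrings₃ (true ∷ true ∷ false ∷ []) ()
isMaxLucas⇒∈maxLucasStrings₃ (true ∷ false ∷ true ∷ []) ()
isMaxLucas⇒∈maxLucasStrings₃ (true ∷ false ∷ false ∷ []) e = here refl
isMaxLucas⇒∈maxLucasStrings₃ (false ∷ true ∷ true ∷ []) ()
isMaxLucas⇒∈maxLucasStrings₃ (false ∷ true ∷ false ∷ []) e = there (here refl)
isMaxLucas⇒∈maxLucasStrings₃ (false ∷ false ∷ true ∷ []) e = there (there (here refl))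
isMaxLucas⇒∈maxLucasStrings₃ (false ∷ false ∷ false ∷ []) ()

isMaxLucas⇒∈maxLucasStrings₄ : ∀ (t : Vtx 4) → isMaxLucas t ≡ true → t ∈ maxLucasStrings 4 (weight t)
isMaxLucas⇒∈maxLucasStrings₄ (true ∷ true ∷ true ∷ true ∷ []) ()
isMaxLucas⇒∈maxLucasStrings₄ (true ∷ true ∷ true ∷ false ∷ []) ()
isMaxLucas⇒∈maxLucasStrings₄ (true ∷ true ∷ false ∷ true ∷ []) ()
isMaxLucas⇒∈maxLucasStrings₄ (true ∷ true ∷ false ∷ false ∷ []) ()
isMaxLucas⇒∈maxLucasStrings₄ (true ∷ false ∷ true ∷ true ∷ []) ()
isMaxLucas⇒∈maxLucasStrings₄ (true ∷ false ∷ true ∷ false ∷ []) e = here refl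
isMaxLucas⇒∈maxLucasStrings₄ (true ∷ false ∷ false ∷ true ∷ []) ()
isMaxLucas⇒∈maxLucasStrings₄ (true ∷ false ∷ false ∷ false ∷ []) ()
isMaxLucas⇒∈maxLucasStrings₄ (false ∷ true ∷ true ∷ true ∷ []) ()
isMaxLucas⇒∈maxLucasStrings₄ (false ∷ true ∷ true ∷ false ∷ []) ()
isMaxLucas⇒∈maxLucasStrings₄ (false ∷ true ∷ false ∷ true ∷ []) e = there (here refl)
isMaxLucas⇒∈maxLucasStrings₄ (false ∷ true ∷ false ∷ false ∷ []) ()
isMaxLucas⇒∈maxLucasStrings₄ (false ∷ false ∷ true ∷ true ∷ []) ()
isMaxLucas⇒∈maxLucasStrings₄ (false ∷ false ∷ true ∷ false ∷ []) ()
isMaxLucas⇒∈maxLucasStrings₄ (false ∷ false ∷ false ∷ true ∷ []) ()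
isMaxLucas⇒∈maxLucasStrings₄ (false ∷ false ∷ false ∷ false ∷ []) ()

isMaxLucas⇒∈maxLucasStrings : ∀ k (t : Vtx (2 + k)) → isMaxLucas t ≡ true → t ∈ maxLucasStrings (2 + k) (weight t)
isMaxLucas⇒∈maxLucasStrings 0 t = isMaxLucas⇒∈maxLucasStrings₂ t
isMaxLucas⇒∈maxLucasStrings 1 t = isMaxLucas⇒∈maxLucasStrings₃ t
isMaxLucas⇒∈maxLucasStrings 2 t = isMaxLucas⇒∈maxLucasStrings₄ t
isMaxLucas⇒∈maxLucasStrings (suc (suc (suc j))) t e = step t e
  where
  viaGrow₂ : ∀ (r : Vtx (3 + j)) → isMaxLucas r ≡ true → grow₂ r ∈ maxLucasStrings (5 + j) (weight (grow₂ r))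
  viaGrow₂ r e = subst (λ q → grow₂ r ∈ maxLucasStrings (5 + j) q) (sym (weight-grow₂ r e))
    (∈-++⁺ˡ (∈-map⁺ grow₂ (isMaxLucas⇒∈maxLucasStrings (suc j) r e)))
  viaGrow₃ : ∀ (r : Vtx (2 + j)) → isMaxLucas r ≡ true → grow₃ r ∈ maxLucasStrings (5 + j) (weight (grow₃ r))
  viaGrow₃ r e = subst (λ q → grow₃ r ∈ maxLucasStrings (5 + j) q) (sym (weight-grow₃ r e))
    (∈-++⁺ʳ (map grow₂ (maxLucasStrings (3 + j) _)) (∈-map⁺ grow₃ (isMaxLucas⇒∈maxLucasStrings j r e)))
  step : ∀ (t : Vtx (5 + j)) → isMaxLucas t ≡ true → t ∈ maxLucasStrings (5 + j) (weight t)
  step (true ∷ true ∷ r) ()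
  step (true ∷ false ∷ true ∷ r) e = viaGrow₂ (true ∷ r) e
  step (true ∷ false ∷ false ∷ true ∷ r) e = viaGrow₃ (true ∷ r) e
  step (true ∷ false ∷ false ∷ false ∷ r) ()
  step (false ∷ false ∷ false ∷ r) ()
  step (false ∷ true ∷ true ∷ r) ()
  step (false ∷ true ∷ false ∷ true ∷ r) e = viaGrow₂ (false ∷ true ∷ r) e
  step (false ∷ true ∷ false ∷ false ∷ true ∷ r) e = viaGrow₃ (false ∷ true ∷ r) e
  step (false ∷ true ∷ false ∷ false ∷ false ∷ r) ()
  step (false ∷ false ∷ true ∷ true ∷ r) ()
  step (false ∷ false ∷ true ∷ false ∷ true ∷ r) e =
    viaGrow₂ (false ∷ false ∷ true ∷ r) (trans (sym (isMaxLucas-grow₂-001 r)) e)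
  step (false ∷ false ∷ true ∷ false ∷ false ∷ true ∷ r) e =
    viaGrow₃ (false ∷ false ∷ true ∷ r) (trans (sym (isMaxLucas-grow₃-001 r)) e)
  step (false ∷ false ∷ true ∷ false ∷ false ∷ false ∷ r) ()

grow₂≢grow₃ : ∀ {m} (t : Vtx (suc m)) (t' : Vtx m) → isMaxLucas t ≡ true → isMaxLucas t' ≡ true →
              grow₂ t ≢ grow₃ t'
grow₂≢grow₃ (false ∷ []) t' () e' eq
grow₂≢grow₃ (false ∷ false ∷ []) t' () e' eq
grow₂≢grow₃ (false ∷ false ∷ false ∷ r) t' () e' eq
grow₂≢grow₃ t [] e () eq
grow₂≢grow₃ t (false ∷ []) e () eq
grow₂≢grow₃ t (false ∷ false ∷ []) e () eq
grow₂≢grow₃ t (false ∷ false ∷ false ∷ r) e () eq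
grow₂≢grow₃ (true ∷ r) (true ∷ r') e e' ()
grow₂≢grow₃ (true ∷ r) (false ∷ true ∷ r') e e' ()
grow₂≢grow₃ (true ∷ r) (false ∷ false ∷ true ∷ r') e e' ()
grow₂≢grow₃ (false ∷ true ∷ r) (true ∷ r') e e' ()
grow₂≢grow₃ (false ∷ true ∷ r) (false ∷ true ∷ r') e e' ()
grow₂≢grow₃ (false ∷ true ∷ r) (false ∷ false ∷ true ∷ r') e e' ()
grow₂≢grow₃ (false ∷ false ∷ true ∷ r) (true ∷ r') e e' ()
grow₂≢grow₃ (false ∷ false ∷ true ∷ r) (false ∷ true ∷ r') e e' ()
grow₂≢grow₃ (false ∷ false ∷ true ∷ r) (false ∷ false ∷ true ∷ r') e e' ()

maxLucasStrings-unique : ∀ n p → Unique (maxLucasStrings n p)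
maxLucasStrings-unique 0 0 = [] ∷ []
maxLucasStrings-unique 1 0 = [] ∷ []
maxLucasStrings-unique 2 1 = ((λ ()) ∷ []) ∷ [] ∷ []
maxLucasStrings-unique 3 1 = ((λ ()) ∷ (λ ()) ∷ []) ∷ ((λ ()) ∷ []) ∷ [] ∷ []
maxLucasStrings-unique 4 2 = ((λ ()) ∷ []) ∷ [] ∷ []
maxLucasStrings-unique (suc (suc (suc (suc (suc k))))) (suc p) =
  Unique.++⁺ (Unique.map⁺ (injective shrink₂ shrink₂-grow₂) (maxLucasStrings-unique (3 + k) p))
             (Unique.map⁺ (injective shrink₃ shrink₃-grow₃) (maxLucasStrings-unique (2 + k) p))
             disjoint
  where
  injective : ∀ {m m'} {f : Vtx m → Vtx m'} (g : Vtx m' → Vtx m) → (∀ x → g (f x) ≡ x) →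
              ∀ {x y} → f x ≡ f y → x ≡ y
  injective g g∘f {x} {y} e = trans (sym (g∘f x)) (trans (cong g e) (g∘f y))
  disjoint : ∀ {v} → ¬ (v ∈ map grow₂ (maxLucasStrings (3 + k) p) × v ∈ map grow₃ (maxLucasStrings (2 + k) p))
  disjoint (v∈₂ , v∈₃) with ∈-map⁻ grow₂ v∈₂ | ∈-map⁻ grow₃ v∈₃
  ... | t , t∈ , refl | t' , t'∈ , eq =
    grow₂≢grow₃ t t' (proj₁ (All.lookup (maxLucasStrings-isMaxLucas (suc k) p) t∈))
                     (proj₁ (All.lookup (maxLucasStrings-isMaxLucas k p) t'∈)) eq
maxLucasStrings-unique 0 (suc p) = []
maxLucasStrings-unique 1 (suc p) = []
maxLucasStrings-unique 2 0 = []
maxLucasStrings-unique 2 (suc (suc p)) = []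
maxLucasStrings-unique 3 0 = []
maxLucasStrings-unique 3 (suc (suc p)) = []
maxLucasStrings-unique 4 0 = []
maxLucasStrings-unique 4 1 = []
maxLucasStrings-unique 4 (suc (suc (suc p))) = []
maxLucasStrings-unique (suc (suc (suc (suc (suc k))))) 0 = []

maxLucasStrings-sound : ∀ n p (t : Vtx n) → t ∈ maxLucasStrings n p → isLucas t ≡ true × Saturated t × weight t ≡ p
maxLucasStrings-sound 0 0 [] (here refl) = refl , (λ { [] _ () }) , refl
maxLucasStrings-sound 1 0 t (here refl) = refl , (λ { (false ∷ []) _ _ → refl ; (true ∷ []) () _ }) , refl
maxLucasStrings-sound (suc (suc k)) p (a ∷ x ∷ w) t∈ =
  let (maxt , wt) = All.lookup (maxLucasStrings-isMaxLucas k p) t∈ in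
  isMaxLucas⇒isLucas a (x ∷ w) maxt , isMaxLucas⇒Saturated a x w maxt , wt

maxLucasStrings-complete : ∀ n (t : Vtx n) → isLucas t ≡ true → Saturated t → t ∈ maxLucasStrings n (weight t)
maxLucasStrings-complete 0 [] _ _ = here refl
maxLucasStrings-complete 1 (false ∷ []) _ _ = here refl
maxLucasStrings-complete (suc (suc k)) (a ∷ x ∷ w) lu sat =
  isMaxLucas⇒∈maxLucasStrings k (a ∷ x ∷ w) (Saturated⇒isMaxLucas a x w lu sat)

Unique-lookup-injective : ∀ {A : Set} (xs : List A) → Unique xs → ∀ i j → List.lookup xs i ≡ List.lookup xs j → i ≡ j
Unique-lookup-injective (x ∷ xs) (x∉xs ∷ u) zero zero e = refl
Unique-lookup-injective (x ∷ xs) (x∉xs ∷ u) zero (suc j) e = ⊥-elim (All.lookup x∉xs (∈-lookup j) e)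
Unique-lookup-injective (x ∷ xs) (x∉xs ∷ u) (suc i) zero e = ⊥-elim (All.lookup x∉xs (∈-lookup i) (sym e))
Unique-lookup-injective (x ∷ xs) (x∉xs ∷ u) (suc i) (suc j) e = cong suc (Unique-lookup-injective xs u i j e)

maxHypercubeCount : ℕ → ℕ → ℕ
maxHypercubeCount n p = length (maxLucasStrings n p)

maxHypercubeCount-correct : ∀ n p → HasCount (IsMaxHypercube n p) (maxHypercubeCount n p)
maxHypercubeCount-correct n p = cube , cube-isMax , cube-injective , cube-onto
  where
  cube : Fin (maxHypercubeCount n p) → VSet n
  cube i = downset (List.lookup (maxLucasStrings n p) i)
  cube-isMax : ∀ i → IsMaxHypercube n p (cube i)
  cube-isMax i = let (lu , sat , wt) = maxLucasStrings-sound n p _ (∈-lookup i) in downset-isMaxHypercube _ lu sat wt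
  cube-injective : ∀ i j → cube i ≐ cube j → i ≡ j
  cube-injective i j e = Unique-lookup-injective _ (maxLucasStrings-unique n p) i j (downset-injective _ _ e)
  cube-onto : ∀ S → IsMaxHypercube n p S → Σ (Fin (maxHypercubeCount n p)) λ i → cube i ≐ S
  cube-onto S h with isMaxHypercube⇒downset S h
  ... | t , lu , sat , wt , t≐S = Any.index t∈ , λ v → trans (cong (λ q → downset q v) (sym (lookup-index t∈))) (t≐S v)
    where t∈ = subst (λ q → t ∈ maxLucasStrings n q) wt (maxLucasStrings-complete n t lu sat)

maxHypercubeCount-step : ∀ k p →
  maxHypercubeCount (5 + k) (suc p) ≡ maxHypercubeCount (3 + k) p + maxHypercubeCount (2 + k) p
maxHypercubeCount-step k p = begin
  length (map grow₂ (maxLucasStrings (3 + k) p) ++ map grow₃ (maxLucasStrings (2 + k) p))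
    ≡⟨ length-++ (map grow₂ (maxLucasStrings (3 + k) p)) ⟩
  length (map grow₂ (maxLucasStrings (3 + k) p)) + length (map grow₃ (maxLucasStrings (2 + k) p))
    ≡⟨ cong₂ _+_ (length-map grow₂ (maxLucasStrings (3 + k) p)) (length-map grow₃ (maxLucasStrings (2 + k) p)) ⟩
  maxHypercubeCount (3 + k) p + maxHypercubeCount (2 + k) p ∎
  where open ≡-Reasoning

maxHypercubeCount-recurrence : ∀ n → 5 ≤ n →
  maxHypercubeCount n 0 ≡ 0 ×
  (∀ p → maxHypercubeCount n (suc p) ≡ maxHypercubeCount (n ∸ 2) p + maxHypercubeCount (n ∸ 3) p)
maxHypercubeCount-recurrence (suc (suc (suc (suc (suc k))))) _ = refl , maxHypercubeCount-step k
maxHypercubeCount-recurrence 1 (s≤s ())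
maxHypercubeCount-recurrence 2 (s≤s (s≤s ()))
maxHypercubeCount-recurrence 3 (s≤s (s≤s (s≤s ())))
maxHypercubeCount-recurrence 4 (s≤s (s≤s (s≤s (s≤s ()))))

maxHypercubeCount-0 : ∀ p → maxHypercubeCount 0 p ≡ coeffs (1 ∷ []) p
maxHypercubeCount-0 zero = refl
maxHypercubeCount-0 (suc p) = refl

maxHypercubeCount-1 : ∀ p → maxHypercubeCount 1 p ≡ coeffs (1 ∷ []) p
maxHypercubeCount-1 zero = refl
maxHypercubeCount-1 (suc p) = refl

maxHypercubeCount-2 : ∀ p → maxHypercubeCount 2 p ≡ coeffs (0 ∷ 2 ∷ []) p
maxHypercubeCount-2 0 = refl
maxHypercubeCount-2 1 = refl
maxHypercubeCount-2 (suc (suc p)) = refl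

maxHypercubeCount-3 : ∀ p → maxHypercubeCount 3 p ≡ coeffs (0 ∷ 3 ∷ []) p
maxHypercubeCount-3 0 = refl
maxHypercubeCount-3 1 = refl
maxHypercubeCount-3 (suc (suc p)) = refl

maxHypercubeCount-4 : ∀ p → maxHypercubeCount 4 p ≡ coeffs (0 ∷ 0 ∷ 2 ∷ []) p
maxHypercubeCount-4 0 = refl
maxHypercubeCount-4 1 = refl
maxHypercubeCount-4 2 = refl
maxHypercubeCount-4 (suc (suc (suc p))) = refl

-- The generating function

xy²* xy³* : PS2 → PS2
xy²* F (suc (suc n)) (suc p) = F n p
xy²* F _ _ = + 0
xy³* F (suc (suc (suc n))) (suc p) = F n p
xy³* F _ _ = + 0

sumTo-zero : ∀ p f → (∀ j → f j ≡ + 0) → sumTo p f ≡ + 0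
sumTo-zero zero f z = z 0
sumTo-zero (suc p) f z = cong₂ ℤ._+_ (sumTo-zero p f z) (z (suc p))

sumTo-only0 : ∀ p f → (∀ j → f (suc j) ≡ + 0) → sumTo p f ≡ f 0
sumTo-only0 zero f z = refl
sumTo-only0 (suc p) f z = trans (cong₂ ℤ._+_ (sumTo-only0 p f z) (z p)) (ℤ.+-identityʳ (f 0))

sumTo-only1 : ∀ p f → f 0 ≡ + 0 → (∀ j → f (suc (suc j)) ≡ + 0) → sumTo (suc p) f ≡ f 1
sumTo-only1 zero f z0 z = trans (cong (ℤ._+ f 1) z0) (ℤ.+-identityˡ (f 1))
sumTo-only1 (suc p) f z0 z = trans (cong₂ ℤ._+_ (sumTo-only1 p f z0 z) (z p)) (ℤ.+-identityʳ (f 1))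

sumTo-upTo3 : ∀ m f → (∀ i → f (suc (suc (suc (suc i)))) ≡ + 0) → sumTo (3 + m) f ≡ sumTo 3 f
sumTo-upTo3 zero f z = refl
sumTo-upTo3 (suc m) f z = trans (cong₂ ℤ._+_ (sumTo-upTo3 m f z) (z m)) (ℤ.+-identityʳ _)

denomRow : PS2 → ℕ → ℕ → ℕ → ℤ
denomRow F n p i = sumTo p λ j → denom i j ℤ.* F (n ∸ i) (p ∸ j)

denomRow-0 : ∀ F n p → denomRow F n p 0 ≡ F n p
denomRow-0 F n p = trans (sumTo-only0 p _ (λ j → refl)) (ℤ.*-identityˡ (F n p))

denomRow-1 : ∀ F n p → denomRow F n p 1 ≡ + 0
denomRow-1 F n p = sumTo-zero p _ (λ j → refl)

denomRow-2 : ∀ F n p → denomRow F (2 + n) p 2 ≡ ℤ.- xy²* F (2 + n) p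
denomRow-2 F n zero = refl
denomRow-2 F n (suc p) = trans (sumTo-only1 p _ refl (λ j → refl)) (ℤ.-1*i≡-i (F n p))

denomRow-3 : ∀ F n p → denomRow F (3 + n) p 3 ≡ ℤ.- xy³* F (3 + n) p
denomRow-3 F n zero = refl
denomRow-3 F n (suc p) = trans (sumTo-only1 p _ refl (λ j → refl)) (ℤ.-1*i≡-i (F n p))

denomRow-≥4 : ∀ F n p i → denomRow F n p (4 + i) ≡ + 0
denomRow-≥4 F n p i = sumTo-zero p _ (λ j → refl)

denom-⊛ : ∀ F n p → (denom ⊛ F) n p ≡ F n p ℤ.- xy²* F n p ℤ.- xy³* F n p
denom-⊛ F zero p = trans (denomRow-0 F 0 p) (sym (trans (ℤ.+-identityʳ _) (ℤ.+-identityʳ _)))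
denom-⊛ F 1 p = trans (cong₂ ℤ._+_ (denomRow-0 F 1 p) (denomRow-1 F 1 p)) (sym (ℤ.+-identityʳ _))
denom-⊛ F 2 p = begin
  (denomRow F 2 p 0 ℤ.+ denomRow F 2 p 1) ℤ.+ denomRow F 2 p 2
    ≡⟨ cong₂ ℤ._+_ (cong₂ ℤ._+_ (denomRow-0 F 2 p) (denomRow-1 F 2 p)) (denomRow-2 F 0 p) ⟩
  (F 2 p ℤ.+ + 0) ℤ.- xy²* F 2 p
    ≡⟨ cong (ℤ._- xy²* F 2 p) (ℤ.+-identityʳ (F 2 p)) ⟩
  F 2 p ℤ.- xy²* F 2 p
    ≡⟨ ℤ.+-identityʳ _ ⟨
  F 2 p ℤ.- xy²* F 2 p ℤ.- xy³* F 2 p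
    ∎
  where open ≡-Reasoning
denom-⊛ F (suc (suc (suc m))) p = begin
  (denom ⊛ F) (3 + m) p
    ≡⟨ sumTo-upTo3 m _ (denomRow-≥4 F (3 + m) p) ⟩
  ((denomRow F (3 + m) p 0 ℤ.+ denomRow F (3 + m) p 1) ℤ.+ denomRow F (3 + m) p 2) ℤ.+ denomRow F (3 + m) p 3
    ≡⟨ cong₂ ℤ._+_ (cong₂ ℤ._+_ (cong₂ ℤ._+_ (denomRow-0 F (3 + m) p) (denomRow-1 F (3 + m) p))
                               (denomRow-2 F (suc m) p))
                   (denomRow-3 F m p) ⟩
  ((F (3 + m) p ℤ.+ + 0) ℤ.- xy²* F (3 + m) p) ℤ.- xy³* F (3 + m) p
    ≡⟨ cong (λ z → z ℤ.- xy²* F (3 + m) p ℤ.- xy³* F (3 + m) p) (ℤ.+-identityʳ (F (3 + m) p)) ⟩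
  F (3 + m) p ℤ.- xy²* F (3 + m) p ℤ.- xy³* F (3 + m) p
    ∎
  where open ≡-Reasoning

[m+n]-m-n≡0 : ∀ m n → + (m + n) ℤ.- + m ℤ.- + n ≡ + 0
[m+n]-m-n≡0 m n = begin
  + (m + n) ℤ.- + m ℤ.- + n        ≡⟨ cong (λ z → z ℤ.- + m ℤ.- + n) (ℤ.pos-+ m n) ⟩
  + m ℤ.+ + n ℤ.- + m ℤ.- + n      ≡⟨ cong (ℤ._- + n) (xyx⁻¹≈y ℤ.+-0-abelianGroup (+ m) (+ n)) ⟩
  + n ℤ.- + n                      ≡⟨ ℤ.+-inverseʳ (+ n) ⟩
  + 0                              ∎
  where open ≡-Reasoning

maxHypercubeCount-numer : ∀ n p → let G m q = + maxHypercubeCount m q in G n p ℤ.- xy²* G n p ℤ.- xy³* G n p ≡ numer n p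
maxHypercubeCount-numer 0 0 = refl
maxHypercubeCount-numer 0 (suc p) = refl
maxHypercubeCount-numer 1 0 = refl
maxHypercubeCount-numer 1 (suc p) = refl
maxHypercubeCount-numer 2 0 = refl
maxHypercubeCount-numer 2 1 = refl
maxHypercubeCount-numer 2 (suc (suc p)) = refl
maxHypercubeCount-numer 3 0 = refl
maxHypercubeCount-numer 3 1 = refl
maxHypercubeCount-numer 3 (suc (suc p)) = refl
maxHypercubeCount-numer 4 0 = refl
maxHypercubeCount-numer 4 1 = refl
maxHypercubeCount-numer 4 2 = refl
maxHypercubeCount-numer 4 (suc (suc (suc p))) = refl
maxHypercubeCount-numer (suc (suc (suc (suc (suc k))))) 0 = refl
maxHypercubeCount-numer (suc (suc (suc (suc (suc k))))) (suc p) =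
  trans (cong (λ z → + z ℤ.- + maxHypercubeCount (3 + k) p ℤ.- + maxHypercubeCount (2 + k) p)
               (maxHypercubeCount-step k p))
        ([m+n]-m-n≡0 (maxHypercubeCount (3 + k) p) (maxHypercubeCount (2 + k) p))

corollary2 :
    Σ (ℕ → ℕ → ℕ) λ g →
      (∀ n p → HasCount (IsMaxHypercube n p) (g n p)) ×
      (∀ n → 5 ≤ n → (g n 0 ≡ 0) × (∀ p → g n (suc p) ≡ g (n ∸ 2) p + g (n ∸ 3) p)) ×
      (∀ p → g 0 p ≡ coeffs (1 ∷ []) p) ×
      (∀ p → g 1 p ≡ coeffs (1 ∷ []) p) ×
      (∀ p → g 2 p ≡ coeffs (0 ∷ 2 ∷ []) p) ×
      (∀ p → g 3 p ≡ coeffs (0 ∷ 3 ∷ []) p) ×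
      (∀ p → g 4 p ≡ coeffs (0 ∷ 0 ∷ 2 ∷ []) p) ×
      (∀ n p → (denom ⊛ (λ m q → + g m q)) n p ≡ numer n p)
corollary2 =
  maxHypercubeCount ,
  maxHypercubeCount-correct ,
  maxHypercubeCount-recurrence ,
  maxHypercubeCount-0 , maxHypercubeCount-1 , maxHypercubeCount-2 , maxHypercubeCount-3 , maxHypercubeCount-4 ,
  λ n p → trans (denom-⊛ (λ m q → + maxHypercubeCount m q) n p) (maxHypercubeCount-numer n p)
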